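{- Let $n\ge 0$. The set of proper noncrossing trees with $n$ edges is in bijection with the set $\mathcal{S}_n$ of symmetric ternary trees with $n$ internal vertices. In particular, the number $t_n$ of proper noncrossing trees with $n$ edges equals the number $s_n=|\mathcal{S}_n|$.
   Context: A noncrossing tree with $n$ edges is a tree on the vertex set $\{1,\dots,n+1\}$, the vertices placed in counterclockwise order on a circle, with edges drawn as chords inside the circle that pairwise do not cross. It is rooted at vertex $1$. A descent is an edge $(i,j)$ with $i>j$ such that $i$ is the parent of $j$, i.e. $i$ lies on the path from the root $1$ to $j$. Equivalently, a noncrossing tree is represented as a rooted plane tree in which each non-root vertex $j$ with parent $i$ is labeled $L$ if $i>j$ and $R$ if $i<j$; the root is unlabeled and all children of the root are labeled $R$. In this representation a child labeled $L$ is a "left child", a child labeled $R$ is a "right child", and descents correspond exactly to $L$-labeled vertices. A noncrossing tree is even if its number of descents is even, odd otherwise. If the tree is even, a non-root vertex $v$ is proper if it has an even number of left children and no right child; if the tree is odd, a non-root vertex $v$ is proper if it has an even number of right children and no left child. A noncrossing tree is proper if every non-root vertex is proper. A ternary tree is either a single node or a root with an ordered triple (left, middle, right) of ternary trees; internal vertices are those with children. A symmetric ternary tree is a ternary tree whose root's middle subtree is a symmetric ternary tree and whose right subtree is the mirror reflection of its left subtree (the single node is symmetric). -}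

module Defs where

open import Data.Nat using (ℕ; zero; suc; _+_)
open import Data.Bool using (Bool; true; false; _∧_; not)
open import Data.Nat using (_≡ᵇ_)
open import Data.Product using (Σ; _×_)
open import Relation.Binary.PropositionalEquality using (_≡_)

-- Noncrossing trees, in the labelled rooted plane tree representation
-- given in the paper: every non-root vertex carries a label L (its parent
-- is larger, a descent) or R (its parent is smaller).

data Label : Set where
  L R : Label

mutual
  data PTree : Set where
    node : Forest → PTree

  data Forest : Set where
    []  : Forest
    cons : Label → PTree → Forest → Forest

even : ℕ → Bool
even zero = true
even (suc n) = not (even n)

mutual
  sizeT : PTree → ℕ
  sizeT (node f) = suc (sizeF f)

  sizeF : Forest → ℕ
  sizeF [] = 0
  sizeF (cons _ t f) = sizeT t + sizeF f

isL : Label → Bool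
isL L = true
isL R = false

countL countR : Forest → ℕ
countL [] = 0
countL (cons L _ f) = suc (countL f)
countL (cons R _ f) = countL f
countR [] = 0
countR (cons R _ f) = suc (countR f)
countR (cons L _ f) = countR f

allR : Forest → Bool
allR [] = true
allR (cons L _ _) = false
allR (cons R _ f) = allR f

mutual
  descT : PTree → ℕ
  descT (node f) = descF f

  descF : Forest → ℕ
  descF [] = 0
  descF (cons L t f) = suc (descT t + descF f)
  descF (cons R t f) = descT t + descF f

-- properness of a vertex with children forest f, given the tree parity
-- (b = true: tree is even)
properVertex : Bool → Forest → Bool
properVertex true  f = even (countL f) ∧ (countR f ≡ᵇ 0)
properVertex false f = even (countR f) ∧ (countL f ≡ᵇ 0)

mutual
  allProperT : Bool → PTree → Bool
  allProperT b (node f) = properVertex b f ∧ allProperF b f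

  allProperF : Bool → Forest → Bool
  allProperF b [] = true
  allProperF b (cons _ t f) = allProperT b t ∧ allProperF b f

-- A noncrossing tree is given by the forest of children of the root
-- (whose labels must all be R); n edges = number of non-root vertices.
isNCTree : ℕ → Forest → Set
isNCTree n f = (allR f ≡ true) × (sizeF f ≡ n)

isProper : Forest → Bool
isProper f = allProperF (even (descF f)) f

ProperNCTree : ℕ → Set
ProperNCTree n = Σ Forest (λ f → isNCTree n f × (isProper f ≡ true))

data Ternary : Set where
  leaf : Ternary
  tnode : Ternary → Ternary → Ternary → Ternary

internal : Ternary → ℕ
internal leaf = 0
internal (tnode l m r) = suc (internal l + internal m + internal r)

mirror : Ternary → Ternary
mirror leaf = leaf
mirror (tnode l m r) = tnode (mirror r) (mirror m) (mirror l)

data Symmetric : Ternary → Set where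
  sym-leaf : Symmetric leaf
  sym-node : ∀ {l m r} → Symmetric m → r ≡ mirror l → Symmetric (tnode l m r)

SymTernary : ℕ → Set
SymTernary n = Σ Ternary (λ t → Symmetric t × (internal t ≡ n))

{-# OPTIONS --safe #-}
-- In an odd tree a proper vertex has no left child, so an odd proper tree has no
-- descents at all, which is absurd; hence proper trees are even, and below the root
-- every vertex has an even number of children, all of them left children.  Cutting
-- such a child list into its first two children and the remaining siblings, a forest
-- of this kind is a ternary tree in disguise, with twice as many vertices as internal
-- nodes.  The child list e₁ … e_k of the root then becomes the symmetric ternary tree
-- whose middle spine has length k and whose i-th left and right subtrees are the
-- ternary tree of eᵢ and its mirror image.
module Submission where

open import Defs
open import Data.Nat using (ℕ; zero; suc; _+_; _≡ᵇ_)
open import Data.Nat.Properties using (+-suc)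
import Data.Nat.Properties as ℕ
open import Data.Nat.Tactic.RingSolver using (solve-∀)
open import Data.Bool using (Bool; true; false; _∧_)
open import Data.Bool.Properties using (not-involutive)
import Data.Bool.Properties as Bool
open import Data.Product using (Σ; _×_; _,_; proj₁; proj₂)
open import Function.Bundles using (_↔_; mk↔ₛ′)
open import Relation.Binary.Definitions using (DecidableEquality)
open import Relation.Binary.PropositionalEquality
open import Relation.Nullary using (yes; no; Irrelevant)
open import Relation.Nullary.Decidable using (map′; _×-dec_)
open import Axiom.UniquenessOfIdentityProofs using (UIP; module Decidable⇒UIP)

open ≡-Reasoning

∧-split : ∀ x {y} → x ∧ y ≡ true → x ≡ true × y ≡ true
∧-split true p = refl , p

even-double+ : ∀ k n → even (k + k + n) ≡ even n
even-double+ zero    n = refl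
even-double+ (suc k) n rewrite +-suc k k = trans (not-involutive _) (even-double+ k n)

allR⇒noL : ∀ f → allR f ≡ true → (countL f ≡ᵇ 0) ≡ true
allR⇒noL []           _  = refl
allR⇒noL (cons R _ f) ar = allR⇒noL f ar

noL⇒descF≡0 : ∀ f → (countL f ≡ᵇ 0) ≡ true → allProperF false f ≡ true → descF f ≡ 0
noL⇒descF≡0 []                  _ _  = refl
noL⇒descF≡0 (cons R (node g) f) noL ap
  with g-vertex , g-below ← ∧-split (properVertex false g) (∧-split _ ap .proj₁)
  = cong₂ _+_ (noL⇒descF≡0 g (∧-split (even (countR g)) g-vertex .proj₂) g-below)
              (noL⇒descF≡0 f noL (∧-split _ ap .proj₂))

proper⇒even : ∀ f → allR f ≡ true → isProper f ≡ true → even (descF f) ≡ true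
proper⇒even f ar pr with even (descF f) in parity
... | true  = refl
... | false = trans (sym parity) (cong even (noL⇒descF≡0 f (allR⇒noL f ar) pr))

data Paired : Forest → Set where
  []   : Paired []
  pair : ∀ {a b c} → Paired a → Paired b → Paired c →
         Paired (cons L (node a) (cons L (node b) c))

data ProperShape : Forest → Set where
  []  : ProperShape []
  _∷_ : ∀ {e f} → Paired e → ProperShape f → ProperShape (cons R (node e) f)

properVertex-LL : ∀ x y c → properVertex true (cons L x (cons L y c)) ≡ properVertex true c
properVertex-LL _ _ c = cong (_∧ (countR c ≡ᵇ 0)) (not-involutive (even (countL c)))

properVertex⇒noR : ∀ e → properVertex true e ≡ true → (countR e ≡ᵇ 0) ≡ true
properVertex⇒noR e p = ∧-split (even (countL e)) p .proj₂

allProperT⇒Paired : ∀ e → allProperT true (node e) ≡ true → Paired e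
allProperT⇒Paired [] _ = []
allProperT⇒Paired (cons L (node a) (cons L (node b) c)) ap
  with vertex , below ← ∧-split _ ap
  with a-proper , bc-proper ← ∧-split (allProperT true (node a)) below
  with b-proper , c-below ← ∧-split (allProperT true (node b)) bc-proper
  = pair (allProperT⇒Paired a a-proper) (allProperT⇒Paired b b-proper) (allProperT⇒Paired c c-proper)
  where
  c-proper : allProperT true (node c) ≡ true
  c-proper = cong₂ _∧_ (trans (sym (properVertex-LL (node a) (node b) c)) vertex) c-below
allProperT⇒Paired (cons L _ []) ()
allProperT⇒Paired e@(cons R _ _) ap with () ← properVertex⇒noR e (∧-split _ ap .proj₁)
allProperT⇒Paired e@(cons L _ (cons R _ _)) ap with () ← properVertex⇒noR e (∧-split _ ap .proj₁)

Paired⇒allProperT : ∀ {e} → Paired e → allProperT true (node e) ≡ true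
Paired⇒allProperT [] = refl
Paired⇒allProperT (pair {a} {b} {c} pa pb pc)
  with c-vertex , c-below ← ∧-split (properVertex true c) (Paired⇒allProperT pc)
  = cong₂ _∧_ (trans (properVertex-LL (node a) (node b) c) c-vertex)
              (cong₂ _∧_ (Paired⇒allProperT pa) (cong₂ _∧_ (Paired⇒allProperT pb) c-below))

allProperF⇒ProperShape : ∀ f → allR f ≡ true → allProperF true f ≡ true → ProperShape f
allProperF⇒ProperShape []                  _  _  = []
allProperF⇒ProperShape (cons R (node e) f) ar ap =
  allProperT⇒Paired e (∧-split _ ap .proj₁) ∷ allProperF⇒ProperShape f ar (∧-split _ ap .proj₂)

isProper⇒ProperShape : ∀ f → allR f ≡ true → isProper f ≡ true → ProperShape f
isProper⇒ProperShape f ar pr =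
  allProperF⇒ProperShape f ar (subst (λ b → allProperF b f ≡ true) (proper⇒even f ar pr) pr)

ProperShape⇒allR : ∀ {f} → ProperShape f → allR f ≡ true
ProperShape⇒allR []      = refl
ProperShape⇒allR (_ ∷ s) = ProperShape⇒allR s

ProperShape⇒allProperF : ∀ {f} → ProperShape f → allProperF true f ≡ true
ProperShape⇒allProperF []      = refl
ProperShape⇒allProperF (p ∷ s) = cong₂ _∧_ (Paired⇒allProperT p) (ProperShape⇒allProperF s)

toTernary : Forest → Ternary
toTernary (cons _ (node a) (cons _ (node b) c)) = tnode (toTernary a) (toTernary b) (toTernary c)
toTernary _                                     = leaf

fromTernary : Ternary → Forest
fromTernary leaf          = []
fromTernary (tnode a b c) =
  cons L (node (fromTernary a)) (cons L (node (fromTernary b)) (fromTernary c))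

toSymmetric : Forest → Ternary
toSymmetric []                  = leaf
toSymmetric (cons _ (node e) f) = tnode (toTernary e) (toSymmetric f) (mirror (toTernary e))

fromSymmetric : Ternary → Forest
fromSymmetric leaf          = []
fromSymmetric (tnode l m _) = cons R (node (fromTernary l)) (fromSymmetric m)

toSymmetric-symmetric : ∀ f → Symmetric (toSymmetric f)
toSymmetric-symmetric []                  = sym-leaf
toSymmetric-symmetric (cons _ (node _) f) = sym-node (toSymmetric-symmetric f) refl

fromTernary-paired : ∀ t → Paired (fromTernary t)
fromTernary-paired leaf          = []
fromTernary-paired (tnode a b c) =
  pair (fromTernary-paired a) (fromTernary-paired b) (fromTernary-paired c)

fromSymmetric-properShape : ∀ t → ProperShape (fromSymmetric t)
fromSymmetric-properShape leaf          = []
fromSymmetric-properShape (tnode l m _) = fromTernary-paired l ∷ fromSymmetric-properShape m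

toTernary-fromTernary : ∀ t → toTernary (fromTernary t) ≡ t
toTernary-fromTernary leaf = refl
toTernary-fromTernary (tnode a b c)
  rewrite toTernary-fromTernary a | toTernary-fromTernary b | toTernary-fromTernary c = refl

fromTernary-toTernary : ∀ {e} → Paired e → fromTernary (toTernary e) ≡ e
fromTernary-toTernary [] = refl
fromTernary-toTernary (pair pa pb pc)
  rewrite fromTernary-toTernary pa | fromTernary-toTernary pb | fromTernary-toTernary pc = refl

toSymmetric-fromSymmetric : ∀ {t} → Symmetric t → toSymmetric (fromSymmetric t) ≡ t
toSymmetric-fromSymmetric sym-leaf = refl
toSymmetric-fromSymmetric (sym-node {l} s refl)
  rewrite toTernary-fromTernary l | toSymmetric-fromSymmetric s = refl

fromSymmetric-toSymmetric : ∀ {f} → ProperShape f → fromSymmetric (toSymmetric f) ≡ f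
fromSymmetric-toSymmetric [] = refl
fromSymmetric-toSymmetric (p ∷ s)
  rewrite fromTernary-toTernary p | fromSymmetric-toSymmetric s = refl

internal-mirror : ∀ t → internal (mirror t) ≡ internal t
internal-mirror leaf = refl
internal-mirror (tnode a b c)
  rewrite internal-mirror a | internal-mirror b | internal-mirror c =
    swap (internal a) (internal b) (internal c)
  where
  swap : ∀ x y z → suc (z + y + x) ≡ suc (x + y + z)
  swap = solve-∀

sizeF-fromTernary : ∀ t → sizeF (fromTernary t) ≡ internal t + internal t
sizeF-fromTernary leaf = refl
sizeF-fromTernary (tnode a b c)
  rewrite sizeF-fromTernary a | sizeF-fromTernary b | sizeF-fromTernary c =
    regroup (internal a) (internal b) (internal c)
  where
  regroup : ∀ x y z → suc (x + x) + (suc (y + y) + (z + z)) ≡ suc (x + y + z) + suc (x + y + z)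
  regroup = solve-∀

descF-fromTernary : ∀ t → descF (fromTernary t) ≡ internal t + internal t
descF-fromTernary leaf = refl
descF-fromTernary (tnode a b c)
  rewrite descF-fromTernary a | descF-fromTernary b | descF-fromTernary c =
    regroup (internal a) (internal b) (internal c)
  where
  regroup : ∀ x y z → suc (x + x + suc (y + y + (z + z))) ≡ suc (x + y + z) + suc (x + y + z)
  regroup = solve-∀

sizeF-fromSymmetric : ∀ {t} → Symmetric t → sizeF (fromSymmetric t) ≡ internal t
sizeF-fromSymmetric sym-leaf = refl
sizeF-fromSymmetric (sym-node {l} {m} s refl) = begin
  suc (sizeF (fromTernary l)) + sizeF (fromSymmetric m)
    ≡⟨ cong₂ (λ x y → suc x + y) (sizeF-fromTernary l) (sizeF-fromSymmetric s) ⟩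
  suc (internal l + internal l) + internal m
    ≡⟨ regroup (internal l) (internal m) ⟩
  suc (internal l + internal m + internal l)
    ≡⟨ cong (λ x → suc (internal l + internal m + x)) (sym (internal-mirror l)) ⟩
  suc (internal l + internal m + internal (mirror l)) ∎
  where
  regroup : ∀ x y → suc (x + x) + y ≡ suc (x + y + x)
  regroup = solve-∀

even-descF-fromSymmetric : ∀ t → even (descF (fromSymmetric t)) ≡ true
even-descF-fromSymmetric leaf = refl
even-descF-fromSymmetric (tnode l m _) rewrite descF-fromTernary l =
  trans (even-double+ (internal l) (descF (fromSymmetric m))) (even-descF-fromSymmetric m)

isProper-fromSymmetric : ∀ t → isProper (fromSymmetric t) ≡ true
isProper-fromSymmetric t rewrite even-descF-fromSymmetric t =
  ProperShape⇒allProperF (fromSymmetric-properShape t)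

infix 4 _≟_
_≟_ : DecidableEquality Ternary
leaf        ≟ leaf           = yes refl
leaf        ≟ tnode _ _ _    = no λ ()
tnode _ _ _ ≟ leaf           = no λ ()
tnode a b c ≟ tnode a' b' c' =
  map′ (λ { (refl , refl , refl) → refl }) (λ { refl → refl , refl , refl })
       (a ≟ a' ×-dec b ≟ b' ×-dec c ≟ c')

Symmetric-irrelevant : ∀ {t} → Irrelevant (Symmetric t)
Symmetric-irrelevant sym-leaf       sym-leaf         = refl
Symmetric-irrelevant (sym-node s p) (sym-node s' p') =
  cong₂ sym-node (Symmetric-irrelevant s s') (Decidable⇒UIP.≡-irrelevant _≟_ p p')

Σ-≡-irrelevant : ∀ {A : Set} {P : A → Set} → (∀ x → Irrelevant (P x)) →
                 ∀ {x y} {p : P x} {q : P y} → x ≡ y → _≡_ {A = Σ A P} (x , p) (y , q)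
Σ-≡-irrelevant irr refl = cong (_ ,_) (irr _ _ _)

ProperNCTree-irrelevant : ∀ {n} f → Irrelevant (isNCTree n f × isProper f ≡ true)
ProperNCTree-irrelevant _ ((r , s) , p) ((r' , s') , p') =
  cong₂ _,_ (cong₂ _,_ (Bool-uip r r') (ℕ.≡-irrelevant s s')) (Bool-uip p p')
  where
  Bool-uip : UIP Bool
  Bool-uip = Decidable⇒UIP.≡-irrelevant Bool._≟_

SymTernary-irrelevant : ∀ {n} t → Irrelevant (Symmetric t × internal t ≡ n)
SymTernary-irrelevant _ (s , i) (s' , i') = cong₂ _,_ (Symmetric-irrelevant s s') (ℕ.≡-irrelevant i i')

toSymTernary : ∀ {n} → ProperNCTree n → SymTernary n
toSymTernary {n} (f , (ar , size) , pr) = toSymmetric f , toSymmetric-symmetric f , (begin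
  internal (toSymmetric f)
    ≡⟨ sizeF-fromSymmetric (toSymmetric-symmetric f) ⟨
  sizeF (fromSymmetric (toSymmetric f))
    ≡⟨ cong sizeF (fromSymmetric-toSymmetric (isProper⇒ProperShape f ar pr)) ⟩
  sizeF f
    ≡⟨ size ⟩
  n ∎)

fromSymTernary : ∀ {n} → SymTernary n → ProperNCTree n
fromSymTernary (t , s , i) =
  fromSymmetric t ,
  (ProperShape⇒allR (fromSymmetric-properShape t) , trans (sizeF-fromSymmetric s) i) ,
  isProper-fromSymmetric t

toSymTernary-fromSymTernary : ∀ {n} (x : SymTernary n) → toSymTernary (fromSymTernary x) ≡ x
toSymTernary-fromSymTernary (t , s , _) =
  Σ-≡-irrelevant SymTernary-irrelevant (toSymmetric-fromSymmetric s)

fromSymTernary-toSymTernary : ∀ {n} (x : ProperNCTree n) → fromSymTernary (toSymTernary x) ≡ x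
fromSymTernary-toSymTernary (f , (ar , _) , pr) =
  Σ-≡-irrelevant ProperNCTree-irrelevant (fromSymmetric-toSymmetric (isProper⇒ProperShape f ar pr))

theorem2p1 : (n : ℕ) → ProperNCTree n ↔ SymTernary n
theorem2p1 n =
  mk↔ₛ′ toSymTernary fromSymTernary toSymTernary-fromSymTernary fromSymTernary-toSymTernary
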